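{- Let $m \geq 2$, $B \in SL_{2}(\mathbb{Z}/2^{m}\mathbb{Z})$ and $n>4$. Let $\Delta_{k}^{B}(m):=\{(a_{1},\ldots,a_{k}) \in (\mathbb{Z}/2^{m}\mathbb{Z})^{k}:~M_{k}(a_{1},\ldots,a_{k})=B \text{ and } a_{2} \text{ is invertible in } \mathbb{Z}/2^m\mathbb{Z}\}$. Then \[\left|\Delta_{n}^{B}(m)\right|=2^{m-1}\left|\Delta_{n-1}^{B}(m)\right|+2^{2m-1}\left|\Delta_{n-2}^{B}(m)\right|.\]
   Context: For $a_1,\ldots,a_k$ in a commutative unitary ring, $M_{k}(a_1,\ldots,a_k):=\begin{pmatrix} a_{k} & -1 \\ 1 & 0\end{pmatrix}\begin{pmatrix} a_{k-1} & -1 \\ 1 & 0\end{pmatrix}\cdots\begin{pmatrix} a_{1} & -1 \\ 1 & 0\end{pmatrix}$. -}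

module Defs where

open import Data.Nat using (ℕ; zero; suc; _+_; _*_; _^_; _∸_; NonZero)
open import Data.Nat.Properties using (m^n≢0)
open import Data.Nat.DivMod using (_mod_)
open import Data.Fin using (Fin; toℕ)
import Data.Fin.Properties as FinP
open import Data.Vec using (Vec; []; _∷_)
open import Data.List using (List; []; _∷_; map; concatMap; filter; length)
import Data.List as L
open import Data.Product using (Σ; _×_; _,_)
open import Relation.Binary.PropositionalEquality using (_≡_; refl; cong)
open import Relation.Nullary using (Dec; yes; no)
open import Relation.Nullary.Decidable using (_×-dec_; map′)
open import Data.Empty using (⊥)

N : ℕ → ℕ
N m = 2 ^ m

_modN_ : ℕ → (m : ℕ) → Fin (N m)
x modN m = _mod_ x (N m) {{m^n≢0 2 m}}

record Zmod (m : ℕ) : Set where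
  constructor ⟦_⟧
  field
    val : Fin (N m)
open Zmod public

module _ {m : ℕ} where
  infixl 6 _+ₘ_
  infixl 7 _*ₘ_
  _+ₘ_ : Zmod m → Zmod m → Zmod m
  a +ₘ b = ⟦ (toℕ (val a) + toℕ (val b)) modN m ⟧

  _*ₘ_ : Zmod m → Zmod m → Zmod m
  a *ₘ b = ⟦ (toℕ (val a) * toℕ (val b)) modN m ⟧

  -ₘ_ : Zmod m → Zmod m
  -ₘ a = ⟦ (N m ∸ toℕ (val a)) modN m ⟧

  0ₘ 1ₘ : Zmod m
  0ₘ = ⟦ 0 modN m ⟧
  1ₘ = ⟦ 1 modN m ⟧

  Invertible : Zmod m → Set
  Invertible a = Σ (Zmod m) λ b → a *ₘ b ≡ 1ₘ

record Mat2 (m : ℕ) : Set where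
  constructor mat
  field
    e11 e12 e21 e22 : Zmod m

module _ {m : ℕ} where
  _·_ : Mat2 m → Mat2 m → Mat2 m
  mat a b c d · mat a' b' c' d' =
    mat (a *ₘ a' +ₘ b *ₘ c') (a *ₘ b' +ₘ b *ₘ d')
        (c *ₘ a' +ₘ d *ₘ c') (c *ₘ b' +ₘ d *ₘ d')

  I₂ : Mat2 m
  I₂ = mat 1ₘ 0ₘ 0ₘ 1ₘ

  det : Mat2 m → Zmod m
  det (mat a b c d) = a *ₘ d +ₘ -ₘ (b *ₘ c)

  InSL2 : Mat2 m → Set
  InSL2 B = det B ≡ 1ₘ

  Mᵢ : Zmod m → Mat2 m
  Mᵢ a = mat a (-ₘ 1ₘ) 1ₘ 0ₘ

  Mk-acc : ∀ {k} → Mat2 m → Vec (Zmod m) k → Mat2 m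
  Mk-acc acc [] = acc
  Mk-acc acc (a ∷ as) = Mk-acc (Mᵢ a · acc) as

  -- M_k(a₁,…,a_k) = Mᵢ(a_k) ⋯ Mᵢ(a₁), for the vector (a₁,…,a_k)
  Mk : ∀ {k} → Vec (Zmod m) k → Mat2 m
  Mk = Mk-acc I₂

  -- "a₂ is invertible" (false for tuples of length < 2, which never occur
  -- in the statement since n > 4)
  A2Inv : ∀ {k} → Vec (Zmod m) k → Set
  A2Inv (_ ∷ a₂ ∷ _) = Invertible a₂
  A2Inv [] = ⊥
  A2Inv (_ ∷ []) = ⊥

  InΔ : ∀ {k} → Mat2 m → Vec (Zmod m) k → Set
  InΔ B v = (Mk v ≡ B) × A2Inv v

module _ {m : ℕ} where
  _≟Z_ : (a b : Zmod m) → Dec (a ≡ b)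
  ⟦ x ⟧ ≟Z ⟦ y ⟧ = map′ (cong ⟦_⟧) (cong val) (x FinP.≟ y)

  _≟M_ : (A B : Mat2 m) → Dec (A ≡ B)
  mat a b c d ≟M mat a' b' c' d' =
    map′ (λ { (refl , refl , refl , refl) → refl })
         (λ { refl → refl , refl , refl , refl })
         (a ≟Z a' ×-dec (b ≟Z b' ×-dec (c ≟Z c' ×-dec d ≟Z d')))

  invertible? : (a : Zmod m) → Dec (Invertible a)
  invertible? a =
    map′ (λ { (x , p) → ⟦ x ⟧ , p }) (λ { (⟦ x ⟧ , p) → x , p })
         (FinP.any? (λ x → (a *ₘ ⟦ x ⟧) ≟Z 1ₘ))

  a2Inv? : ∀ {k} (v : Vec (Zmod m) k) → Dec (A2Inv v)
  a2Inv? [] = no λ ()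
  a2Inv? (_ ∷ []) = no λ ()
  a2Inv? (_ ∷ a₂ ∷ _) = invertible? a₂

  inΔ? : ∀ {k} (B : Mat2 m) (v : Vec (Zmod m) k) → Dec (InΔ B v)
  inΔ? B v = (Mk v ≟M B) ×-dec a2Inv? v

allZmod : (m : ℕ) → List (Zmod m)
allZmod m = map ⟦_⟧ (L.allFin (N m))

allVecs : ∀ {A : Set} → List A → (k : ℕ) → List (Vec A k)
allVecs xs zero = [] ∷ []
allVecs xs (suc k) = concatMap (λ x → map (x ∷_) (allVecs xs k)) xs

cardΔ : (m k : ℕ) → Mat2 m → ℕ
cardΔ m k B = length (filter (inΔ? B) (allVecs (allZmod m) k))

-- Appending a letter c to a tuple multiplies M by Mᵢ c on the left, so for k ≥ 2
-- |Δ_{k+1}^B| = Σ_c |Δ_k^{B′}| with B′ = Mᵢ(c)⁻¹B, which sends B = (p q; r s) to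
-- (r s; cr − p, cs − q) and preserves det. Solving for the first letters gives
-- |Δ_2^B| = [det B = 1][s = −1][q odd] and then |Δ_3^B| = [det B = 1][s odd], since
-- cs − q = −1 has exactly one solution c when s is a unit (i.e. odd) and none otherwise.
-- Hence for k ≥ 3, |Δ_k^B| = [det B = 1]·g_k(s̄, q̄) depends only on the parities of the
-- right column: the parity of cs − q is c̄s̄ + q̄, and each parity c̄ is attained by
-- 2^{m−1} residues c. So g_{k+1} = T g_k for the linear operator
-- T g(x, y) = 2^{m−1}(g(y, x) + g(x + y, x)) on functions Parity² → ℕ, and the identity
-- T²g₃ = 2^{m−1} T g₃ + 2^{2m−1} g₃, checked on the four parity pairs, propagates to all
-- k by linearity of T.

module Submission where

open import Algebra.Bundles using (CommutativeRing)
import Algebra.Solver.Ring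
open import Algebra.Solver.Ring.AlmostCommutativeRing using (fromCommutativeRing; _-Raw-AlmostCommutative⟶_)
open import Data.Maybe.Base using (Maybe; just; nothing)
open import Data.Nat.Base as ℕ using (ℕ; zero; suc)
import Data.Nat.Properties as ℕ
open import Relation.Nullary.Decidable using (yes; no)
import Relation.Binary.PropositionalEquality as ≡

-- The solver normalises constant coefficients by computation. In ℤ/2^mℤ with m
-- a variable nothing computes, so coefficients are taken in ℤ and interpreted
-- through the canonical homomorphism ℤ → R.
module ℤ-CoefficientSolver {c ℓ} (R : CommutativeRing c ℓ) where
  open import Data.Integer.Base as ℤ using (ℤ; +_; -[1+_]; +[1+_]; _⊖_; sign; ∣_∣; _◃_)
  import Data.Integer.Properties as ℤ
  open import Data.Sign.Base as Sign using (Sign)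
  open CommutativeRing R
  open import Algebra.Properties.Ring ring using (-‿distribˡ-*; -‿distribʳ-*; -‿involutive; -0#≈0#; -‿+-comm)
  open import Algebra.Properties.CommutativeSemigroup +-commutativeSemigroup using (interchange)
  -- the optimised _×_ has 1 × x = x, so that con (+ 1) is literally 1#
  open import Algebra.Properties.Semiring.Mult.TCOptimised semiring using (_×_; ×-homo-+; ×1-homo-*)
  open import Relation.Binary.Reasoning.Setoid setoid

  fromℤ : ℤ → Carrier
  fromℤ (+ n)      = n × 1#
  fromℤ -[1+ n ]   = - (suc n × 1#)

  fromℤ-⊖ : ∀ m n → fromℤ (m ⊖ n) ≈ m × 1# - n × 1#
  fromℤ-⊖ m       zero    = sym (trans (+-congˡ -0#≈0#) (+-identityʳ _))
  fromℤ-⊖ zero    (suc n) = sym (+-identityˡ _)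
  fromℤ-⊖ (suc m) (suc n) = begin
    fromℤ (suc m ⊖ suc n)        ≡⟨ ≡.cong fromℤ (ℤ.[1+m]⊖[1+n]≡m⊖n m n) ⟩
    fromℤ (m ⊖ n)                ≈⟨ fromℤ-⊖ m n ⟩
    x - y                        ≈⟨ +-identityˡ (x - y) ⟨
    0# + (x - y)                 ≈⟨ +-congʳ (-‿inverseʳ 1#) ⟨
    (1# - 1#) + (x - y)          ≈⟨ interchange 1# (- 1#) x (- y) ⟩
    (1# + x) + (- 1# - y)        ≈⟨ +-congˡ (-‿+-comm 1# y) ⟩
    (1# + x) - (1# + y)          ≈⟨ +-cong (×-homo-+ 1# 1 m) (-‿cong (×-homo-+ 1# 1 n)) ⟨
    suc m × 1# - suc n × 1#      ∎
    where x = m × 1#; y = n × 1#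

  fromℤ-+ : ∀ i j → fromℤ (i ℤ.+ j) ≈ fromℤ i + fromℤ j
  fromℤ-+ (+ m)    (+ n)    = ×-homo-+ 1# m n
  fromℤ-+ (+ m)    -[1+ n ] = fromℤ-⊖ m (suc n)
  fromℤ-+ -[1+ m ] (+ n)    = trans (fromℤ-⊖ n (suc m)) (+-comm _ _)
  fromℤ-+ -[1+ m ] -[1+ n ] = begin
    - (suc (suc (m ℕ.+ n)) × 1#)     ≡⟨ ≡.cong (λ k → - (suc k × 1#)) (ℕ.+-suc m n) ⟨
    - ((suc m ℕ.+ suc n) × 1#)       ≈⟨ -‿cong (×-homo-+ 1# (suc m) (suc n)) ⟩
    - (suc m × 1# + suc n × 1#)      ≈⟨ -‿+-comm _ _ ⟨
    - (suc m × 1#) + - (suc n × 1#)  ∎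

  signed : Sign → Carrier → Carrier
  signed Sign.+ x = x
  signed Sign.- x = - x

  signed-cong : ∀ s {x y} → x ≈ y → signed s x ≈ signed s y
  signed-cong Sign.+ x≈y = x≈y
  signed-cong Sign.- x≈y = -‿cong x≈y

  signed-* : ∀ s t x y → signed (s Sign.* t) (x * y) ≈ signed s x * signed t y
  signed-* Sign.+ Sign.+ x y = refl
  signed-* Sign.+ Sign.- x y = -‿distribʳ-* x y
  signed-* Sign.- Sign.+ x y = -‿distribˡ-* x y
  signed-* Sign.- Sign.- x y = begin
    x * y          ≈⟨ -‿involutive (x * y) ⟨
    - - (x * y)    ≈⟨ -‿cong (-‿distribʳ-* x y) ⟩
    - (x * - y)    ≈⟨ -‿distribˡ-* x (- y) ⟩
    - x * - y      ∎

  fromℤ-◃ : ∀ s n → fromℤ (s ◃ n) ≈ signed s (n × 1#)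
  fromℤ-◃ Sign.+ zero    = refl
  fromℤ-◃ Sign.- zero    = sym -0#≈0#
  fromℤ-◃ Sign.+ (suc n) = refl
  fromℤ-◃ Sign.- (suc n) = refl

  fromℤ≈signed : ∀ i → fromℤ i ≈ signed (sign i) (∣ i ∣ × 1#)
  fromℤ≈signed (+ n)    = refl
  fromℤ≈signed -[1+ n ] = refl

  fromℤ-* : ∀ i j → fromℤ (i ℤ.* j) ≈ fromℤ i * fromℤ j
  fromℤ-* i j = begin
    fromℤ (i ℤ.* j)                                    ≈⟨ fromℤ-◃ (s Sign.* t) (∣ i ∣ ℕ.* ∣ j ∣) ⟩
    signed (s Sign.* t) ((∣ i ∣ ℕ.* ∣ j ∣) × 1#)         ≈⟨ signed-cong (s Sign.* t) (×1-homo-* ∣ i ∣ ∣ j ∣) ⟩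
    signed (s Sign.* t) (∣ i ∣ × 1# * ∣ j ∣ × 1#)        ≈⟨ signed-* s t _ _ ⟩
    signed s (∣ i ∣ × 1#) * signed t (∣ j ∣ × 1#)        ≈⟨ *-cong (fromℤ≈signed i) (fromℤ≈signed j) ⟨
    fromℤ i * fromℤ j                                  ∎
    where s = sign i; t = sign j

  fromℤ-‿ : ∀ i → fromℤ (ℤ.- i) ≈ - fromℤ i
  fromℤ-‿ (+ zero) = sym -0#≈0#
  fromℤ-‿ +[1+ n ] = refl
  fromℤ-‿ -[1+ n ] = sym (-‿involutive _)

  fromℤ-homomorphism : ℤ.+-*-rawRing -Raw-AlmostCommutative⟶ fromCommutativeRing R
  fromℤ-homomorphism = record
    { ⟦_⟧ = fromℤ ; +-homo = fromℤ-+ ; *-homo = fromℤ-* ; -‿homo = fromℤ-‿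
    ; 0-homo = refl ; 1-homo = refl }

  fromℤ-≟ : ∀ i j → Maybe (fromℤ i ≈ fromℤ j)
  fromℤ-≟ i j with i ℤ.≟ j
  ... | yes ≡.refl = just refl
  ... | no _       = nothing

  open Algebra.Solver.Ring ℤ.+-*-rawRing (fromCommutativeRing R) fromℤ-homomorphism fromℤ-≟ public

  :0 :1 : ∀ {n} → Polynomial n
  :0 = con (+ 0)
  :1 = con (+ 1)

open import Algebra.Consequences.Propositional using (comm∧idˡ⇒id; comm∧invˡ⇒inv; comm∧distrʳ⇒distr)
open import Algebra.Properties.CommutativeSemigroup ℕ.+-commutativeSemigroup using (interchange)
open import Data.Bool.Base using (true; false; if_then_else_)
open import Data.Fin.Base as Fin using (Fin; toℕ)
import Data.Fin.Properties as Fin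
open import Data.List.Base using (List; []; _∷_; _++_; map; concatMap; filter; length; tabulate)
open import Data.List.Properties using (map-cong; map-∘; map-++; map-tabulate)
open import Data.Nat.Base using (NonZero; _+_; _*_; _^_; _∸_; _≤_; _<_; s≤s; parity)
open import Data.Nat.Coprimality using (Coprime; coprime-Bézout; coprime-divisor)
open import Data.Nat.Divisibility using (_∣_; divides; ∣-trans; ∣⇒≤; 0∣⇒≡0; ∣1⇒≡1)
open import Data.Nat.DivMod using (_%_; _/_; m%n<n; %-distribˡ-+; %-distribˡ-*; m<n⇒m%n≡m; n%n≡0; [m+kn]%n≡m%n; m≡m%n+[m/n]*n)
open import Data.Nat.GCD using (module Bézout)
open import Data.Nat.ListAction using (sum)
open import Data.Nat.ListAction.Properties using (sum-++)
import Data.Nat.Tactic.RingSolver as ℕ-Solver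
open import Data.Parity.Base as ℙ using (Parity; 0ℙ; 1ℙ)
import Data.Parity.Properties as ℙ
open import Data.Product.Base using (_×_; _,_; proj₁; proj₂)
open import Data.Product.Function.NonDependent.Propositional using (_×-⇔_)
open import Data.Vec.Base using (Vec; []; _∷_; _∷ʳ_)
open import Function.Base using (_∘_)
open import Function.Bundles using (_⇔_; mk⇔)
import Function.Properties.Equivalence as ⇔
open import Level using (0ℓ)
open import Relation.Nullary.Decidable using (Dec; _because_; does; _×-dec_; does-⇔)
open import Relation.Nullary.Negation using (contradiction)
open ≡ using (_≡_; refl; sym; trans; cong; cong₂; subst; module ≡-Reasoning)
open ≡-Reasoning

open import Defs

-- Indicators and finite sums

𝟙 : ∀ {a} {A : Set a} → Dec A → ℕ
𝟙 a? = if does a? then 1 else 0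

module _ {a b} {A : Set a} {B : Set b} where

  𝟙-cong : A ⇔ B → (a? : Dec A) (b? : Dec B) → 𝟙 a? ≡ 𝟙 b?
  𝟙-cong A⇔B a? b? = cong (λ t → if t then 1 else 0) (does-⇔ A⇔B a? b?)

  𝟙-× : (a? : Dec A) (b? : Dec B) → 𝟙 (a? ×-dec b?) ≡ 𝟙 a? * 𝟙 b?
  𝟙-× (true  because _) b? = sym (ℕ.+-identityʳ (𝟙 b?))
  𝟙-× (false because _) b? = refl

∑ : {A : Set} → List A → (A → ℕ) → ℕ
∑ xs f = sum (map f xs)

syntax ∑ xs (λ x → f) = ∑[ x ∈ xs ] f

module _ {A : Set} where

  ∑-cong : ∀ xs {f g : A → ℕ} → (∀ x → f x ≡ g x) → ∑ xs f ≡ ∑ xs g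
  ∑-cong xs f≗g = cong sum (map-cong f≗g xs)

  ∑-zeros : ∀ (xs : List A) → ∑[ x ∈ xs ] 0 ≡ 0
  ∑-zeros []       = refl
  ∑-zeros (x ∷ xs) = ∑-zeros xs

  ∑-+ : ∀ xs (f g : A → ℕ) → ∑[ x ∈ xs ] (f x + g x) ≡ ∑ xs f + ∑ xs g
  ∑-+ []       f g = refl
  ∑-+ (x ∷ xs) f g =
    trans (cong ((f x + g x) +_) (∑-+ xs f g)) (interchange (f x) (g x) (∑ xs f) (∑ xs g))

  ∑-*ˡ : ∀ xs c (f : A → ℕ) → ∑[ x ∈ xs ] (c * f x) ≡ c * ∑ xs f
  ∑-*ˡ []       c f = sym (ℕ.*-zeroʳ c)
  ∑-*ˡ (x ∷ xs) c f = trans (cong (c * f x +_) (∑-*ˡ xs c f)) (sym (ℕ.*-distribˡ-+ c (f x) (∑ xs f)))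

  ∑-*ʳ : ∀ xs c (f : A → ℕ) → ∑[ x ∈ xs ] (f x * c) ≡ ∑ xs f * c
  ∑-*ʳ xs c f = trans (∑-cong xs (λ x → ℕ.*-comm (f x) c)) (trans (∑-*ˡ xs c f) (ℕ.*-comm c (∑ xs f)))

  length-filter : ∀ {P : A → Set} (P? : ∀ x → Dec (P x)) xs →
                  length (filter P? xs) ≡ ∑[ x ∈ xs ] 𝟙 (P? x)
  length-filter P? []       = refl
  length-filter P? (x ∷ xs) with does (P? x)
  ... | true  = cong suc (length-filter P? xs)
  ... | false = length-filter P? xs

module _ {A B : Set} where

  ∑-swap : ∀ xs ys (f : A → B → ℕ) → ∑[ x ∈ xs ] ∑ ys (f x) ≡ ∑[ y ∈ ys ] ∑[ x ∈ xs ] f x y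
  ∑-swap []       ys f = sym (∑-zeros ys)
  ∑-swap (x ∷ xs) ys f = trans (cong (∑ ys (f x) +_) (∑-swap xs ys f)) (sym (∑-+ ys (f x) _))

  ∑-map : ∀ xs (h : A → B) (f : B → ℕ) → ∑ (map h xs) f ≡ ∑[ x ∈ xs ] f (h x)
  ∑-map xs h f = cong sum (sym (map-∘ xs))

  ∑-concatMap : ∀ xs (h : A → List B) (f : B → ℕ) → ∑ (concatMap h xs) f ≡ ∑[ x ∈ xs ] ∑ (h x) f
  ∑-concatMap []       h f = refl
  ∑-concatMap (x ∷ xs) h f = begin
    sum (map f (h x ++ concatMap h xs))           ≡⟨ cong sum (map-++ f (h x) (concatMap h xs)) ⟩
    sum (map f (h x) ++ map f (concatMap h xs))   ≡⟨ sum-++ (map f (h x)) _ ⟩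
    ∑ (h x) f + ∑ (concatMap h xs) f              ≡⟨ cong (∑ (h x) f +_) (∑-concatMap xs h f) ⟩
    ∑ (h x) f + ∑[ y ∈ xs ] ∑ (h y) f             ∎

module _ {A : Set} (xs : List A) where

  ∑-allVecs-∷ : ∀ k (f : Vec A (suc k) → ℕ) →
                ∑ (allVecs xs (suc k)) f ≡ ∑[ x ∈ xs ] ∑[ w ∈ allVecs xs k ] f (x ∷ w)
  ∑-allVecs-∷ k f = trans (∑-concatMap xs _ f) (∑-cong xs (λ x → ∑-map (allVecs xs k) (x ∷_) f))

  ∑-allVecs-1 : ∀ (f : Vec A 1 → ℕ) → ∑ (allVecs xs 1) f ≡ ∑[ x ∈ xs ] f (x ∷ [])
  ∑-allVecs-1 f = trans (∑-allVecs-∷ zero f) (∑-cong xs (λ x → ℕ.+-identityʳ (f (x ∷ []))))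

  ∑-allVecs-∷ʳ : ∀ k (f : Vec A (suc k) → ℕ) →
                 ∑ (allVecs xs (suc k)) f ≡ ∑[ u ∈ allVecs xs k ] ∑[ x ∈ xs ] f (u ∷ʳ x)
  ∑-allVecs-∷ʳ zero f = trans (∑-allVecs-1 f) (sym (ℕ.+-identityʳ _))
  ∑-allVecs-∷ʳ (suc k) f = begin
    ∑ (allVecs xs (2 + k)) f                                          ≡⟨ ∑-allVecs-∷ (suc k) f ⟩
    ∑[ x ∈ xs ] ∑[ w ∈ allVecs xs (suc k) ] f (x ∷ w)                 ≡⟨ ∑-cong xs (λ x → ∑-allVecs-∷ʳ k (f ∘ (x ∷_))) ⟩
    ∑[ x ∈ xs ] ∑[ u ∈ allVecs xs k ] ∑[ y ∈ xs ] f (x ∷ (u ∷ʳ y))     ≡⟨ ∑-allVecs-∷ k _ ⟨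
    ∑[ u ∈ allVecs xs (suc k) ] ∑[ y ∈ xs ] f (u ∷ʳ y)                 ∎

sum-tabulate-δ : ∀ {n} (j : Fin n) (g : Fin n → ℕ) → sum (tabulate (λ i → 𝟙 (i Fin.≟ j) * g i)) ≡ g j
sum-tabulate-δ {suc n} Fin.zero g = begin
  1 * g Fin.zero + sum (tabulate {n = n} (λ _ → 0))   ≡⟨ cong (1 * g Fin.zero +_) zeros ⟩
  1 * g Fin.zero + 0                                  ≡⟨ ℕ.+-identityʳ _ ⟩
  1 * g Fin.zero                                      ≡⟨ ℕ.*-identityˡ _ ⟩
  g Fin.zero                                          ∎
  where
  zeros : sum (tabulate {n = n} (λ _ → 0)) ≡ 0
  zeros = trans (cong sum (sym (map-tabulate {n = n} (λ i → i) (λ _ → 0))))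
                (∑-zeros (tabulate {n = n} (λ i → i)))
sum-tabulate-δ (Fin.suc j) g = sum-tabulate-δ j (g ∘ Fin.suc)

sum-tabulate-parity : ∀ k (F : Parity → ℕ) →
                      sum (tabulate {n = k * 2} (λ i → F (parity (toℕ i)))) ≡ k * (F 0ℙ + F 1ℙ)
sum-tabulate-parity zero    F = refl
sum-tabulate-parity (suc k) F =
  trans (sym (ℕ.+-assoc (F 0ℙ) (F 1ℙ) _)) (cong (F 0ℙ + F 1ℙ +_) (sum-tabulate-parity k F))

-- The ring ℤ/2^mℤ

module _ {m : ℕ} where
  private instance
    N-nonZero : NonZero (N m)
    N-nonZero = ℕ.m^n≢0 2 m

  [_]ₘ : ℕ → Zmod m
  [ x ]ₘ = ⟦ x modN m ⟧

  rep : Zmod m → ℕ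
  rep a = toℕ (val a)

  rep-[]ₘ : ∀ x → rep [ x ]ₘ ≡ x % N m
  rep-[]ₘ x = Fin.toℕ-fromℕ< (m%n<n x (N m))

  []ₘ-cong-% : ∀ {x y} → x % N m ≡ y % N m → [ x ]ₘ ≡ [ y ]ₘ
  []ₘ-cong-% {x} {y} eq =
    cong ⟦_⟧ (Fin.toℕ-injective (trans (rep-[]ₘ x) (trans eq (sym (rep-[]ₘ y)))))

  []ₘ-rep : ∀ a → [ rep a ]ₘ ≡ a
  []ₘ-rep ⟦ i ⟧ =
    cong ⟦_⟧ (Fin.toℕ-injective (trans (rep-[]ₘ (toℕ i)) (m<n⇒m%n≡m (Fin.toℕ<n i))))

  []ₘ-+ : ∀ x y → [ x ]ₘ +ₘ [ y ]ₘ ≡ [ x + y ]ₘ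
  []ₘ-+ x y = []ₘ-cong-%
    (trans (cong₂ (λ a b → (a + b) % N m) (rep-[]ₘ x) (rep-[]ₘ y)) (sym (%-distribˡ-+ x y (N m))))

  []ₘ-* : ∀ x y → [ x ]ₘ *ₘ [ y ]ₘ ≡ [ x * y ]ₘ
  []ₘ-* x y = []ₘ-cong-%
    (trans (cong₂ (λ a b → (a * b) % N m) (rep-[]ₘ x) (rep-[]ₘ y)) (sym (%-distribˡ-* x y (N m))))

  [N]ₘ≡0ₘ : [ N m ]ₘ ≡ 0ₘ
  [N]ₘ≡0ₘ = []ₘ-cong-% (trans (n%n≡0 (N m)) (sym (m<n⇒m%n≡m (ℕ.>-nonZero⁻¹ (N m)))))

  Zmod-elim : (P : Zmod m → Set) → (∀ x → P [ x ]ₘ) → ∀ a → P a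
  Zmod-elim P h a = subst P ([]ₘ-rep a) (h (rep a))

  Zmod-elim₃ : (P : Zmod m → Zmod m → Zmod m → Set) → (∀ x y z → P [ x ]ₘ [ y ]ₘ [ z ]ₘ) → ∀ a b c → P a b c
  Zmod-elim₃ P h a b c =
    Zmod-elim (λ a → P a b c) (λ x → Zmod-elim (λ b → P [ x ]ₘ b c) (λ y → Zmod-elim (P [ x ]ₘ [ y ]ₘ) (h x y) c) b) a

  +ₘ-assoc : ∀ a b c → a +ₘ b +ₘ c ≡ a +ₘ (b +ₘ c)
  +ₘ-assoc = Zmod-elim₃ _ λ x y z → begin
    [ x ]ₘ +ₘ [ y ]ₘ +ₘ [ z ]ₘ    ≡⟨ cong (_+ₘ [ z ]ₘ) ([]ₘ-+ x y) ⟩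
    [ x + y ]ₘ +ₘ [ z ]ₘ        ≡⟨ []ₘ-+ (x + y) z ⟩
    [ x + y + z ]ₘ            ≡⟨ cong [_]ₘ (ℕ.+-assoc x y z) ⟩
    [ x + (y + z) ]ₘ          ≡⟨ []ₘ-+ x (y + z) ⟨
    [ x ]ₘ +ₘ [ y + z ]ₘ        ≡⟨ cong ([ x ]ₘ +ₘ_) ([]ₘ-+ y z) ⟨
    [ x ]ₘ +ₘ ([ y ]ₘ +ₘ [ z ]ₘ)  ∎

  *ₘ-assoc : ∀ a b c → a *ₘ b *ₘ c ≡ a *ₘ (b *ₘ c)
  *ₘ-assoc = Zmod-elim₃ _ λ x y z → begin
    [ x ]ₘ *ₘ [ y ]ₘ *ₘ [ z ]ₘ    ≡⟨ cong (_*ₘ [ z ]ₘ) ([]ₘ-* x y) ⟩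
    [ x * y ]ₘ *ₘ [ z ]ₘ        ≡⟨ []ₘ-* (x * y) z ⟩
    [ x * y * z ]ₘ            ≡⟨ cong [_]ₘ (ℕ.*-assoc x y z) ⟩
    [ x * (y * z) ]ₘ          ≡⟨ []ₘ-* x (y * z) ⟨
    [ x ]ₘ *ₘ [ y * z ]ₘ        ≡⟨ cong ([ x ]ₘ *ₘ_) ([]ₘ-* y z) ⟨
    [ x ]ₘ *ₘ ([ y ]ₘ *ₘ [ z ]ₘ)  ∎

  *ₘ-distribʳ-+ₘ : ∀ a b c → (b +ₘ c) *ₘ a ≡ b *ₘ a +ₘ c *ₘ a
  *ₘ-distribʳ-+ₘ = Zmod-elim₃ _ λ x y z → begin
    ([ y ]ₘ +ₘ [ z ]ₘ) *ₘ [ x ]ₘ      ≡⟨ cong (_*ₘ [ x ]ₘ) ([]ₘ-+ y z) ⟩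
    [ y + z ]ₘ *ₘ [ x ]ₘ            ≡⟨ []ₘ-* (y + z) x ⟩
    [ (y + z) * x ]ₘ              ≡⟨ cong [_]ₘ (ℕ.*-distribʳ-+ x y z) ⟩
    [ y * x + z * x ]ₘ          ≡⟨ []ₘ-+ (y * x) (z * x) ⟨
    [ y * x ]ₘ +ₘ [ z * x ]ₘ      ≡⟨ cong₂ _+ₘ_ ([]ₘ-* y x) ([]ₘ-* z x) ⟨
    [ y ]ₘ *ₘ [ x ]ₘ +ₘ [ z ]ₘ *ₘ [ x ]ₘ ∎

  +ₘ-comm : ∀ a b → a +ₘ b ≡ b +ₘ a
  +ₘ-comm a b = cong [_]ₘ (ℕ.+-comm (rep a) (rep b))

  *ₘ-comm : ∀ a b → a *ₘ b ≡ b *ₘ a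
  *ₘ-comm a b = cong [_]ₘ (ℕ.*-comm (rep a) (rep b))

  +ₘ-identityˡ : ∀ a → 0ₘ +ₘ a ≡ a
  +ₘ-identityˡ = Zmod-elim _ ([]ₘ-+ 0)

  *ₘ-identityˡ : ∀ a → 1ₘ *ₘ a ≡ a
  *ₘ-identityˡ = Zmod-elim _ λ x → trans ([]ₘ-* 1 x) (cong [_]ₘ (ℕ.*-identityˡ x))

  -ₘ-inverseˡ : ∀ a → -ₘ a +ₘ a ≡ 0ₘ
  -ₘ-inverseˡ a = begin
    [ N m ∸ rep a ]ₘ +ₘ a           ≡⟨ cong ([ N m ∸ rep a ]ₘ +ₘ_) ([]ₘ-rep a) ⟨
    [ N m ∸ rep a ]ₘ +ₘ [ rep a ]ₘ  ≡⟨ []ₘ-+ (N m ∸ rep a) (rep a) ⟩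
    [ N m ∸ rep a + rep a ]ₘ      ≡⟨ cong [_]ₘ (ℕ.m∸n+n≡m (ℕ.<⇒≤ (Fin.toℕ<n (val a)))) ⟩
    [ N m ]ₘ                          ≡⟨ [N]ₘ≡0ₘ ⟩
    0ₘ                                ∎

module _ (m : ℕ) where
  Zmod-commutativeRing : CommutativeRing 0ℓ 0ℓ
  Zmod-commutativeRing = record
    { Carrier = Zmod m ; _≈_ = _≡_ ; _+_ = _+ₘ_ ; _*_ = _*ₘ_ ; -_ = -ₘ_ ; 0# = 0ₘ ; 1# = 1ₘ
    ; isCommutativeRing = record
      { isRing = record
        { +-isAbelianGroup = record
          { isGroup = record
            { isMonoid = record
              { isSemigroup = record
                { isMagma = record { isEquivalence = ≡.isEquivalence ; ∙-cong = cong₂ _+ₘ_ }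
                ; assoc = +ₘ-assoc }
              ; identity = comm∧idˡ⇒id +ₘ-comm +ₘ-identityˡ }
            ; inverse = comm∧invˡ⇒inv +ₘ-comm -ₘ-inverseˡ
            ; ⁻¹-cong = cong -ₘ_ }
          ; comm = +ₘ-comm }
        ; *-cong = cong₂ _*ₘ_
        ; *-assoc = *ₘ-assoc
        ; *-identity = comm∧idˡ⇒id *ₘ-comm *ₘ-identityˡ
        ; distrib = comm∧distrʳ⇒distr (cong₂ _+ₘ_) *ₘ-comm *ₘ-distribʳ-+ₘ }
      ; *-comm = *ₘ-comm } }

-- Counting solutions and the step from k to k + 1 letters

module _ {m : ℕ} where
  open ℤ-CoefficientSolver (Zmod-commutativeRing m) using (solve; _:=_; _:+_; _:*_; :-_; _:-_; :0; :1)

  ∑-allZmod : ∀ (f : Zmod m → ℕ) → ∑ (allZmod m) f ≡ sum (tabulate (λ i → f ⟦ i ⟧))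
  ∑-allZmod f = cong sum (trans (cong (map f) (map-tabulate (λ i → i) ⟦_⟧)) (map-tabulate ⟦_⟧ f))

  ∑-≟ : ∀ t (g : Zmod m → ℕ) → ∑[ x ∈ allZmod m ] (𝟙 (x ≟Z t) * g x) ≡ g t
  ∑-≟ ⟦ j ⟧ g = trans (∑-allZmod _) (sum-tabulate-δ j (g ∘ ⟦_⟧))

  ∑-unique : ∀ {P : Zmod m → Set} (P? : ∀ x → Dec (P x)) t → (∀ x → P x ⇔ x ≡ t) →
             ∑[ x ∈ allZmod m ] 𝟙 (P? x) ≡ 1
  ∑-unique P? t P⇔≡t = begin
    ∑[ x ∈ allZmod m ] 𝟙 (P? x)
      ≡⟨ ∑-cong (allZmod m) (λ x → trans (𝟙-cong (P⇔≡t x) (P? x) (x ≟Z t)) (sym (ℕ.*-identityʳ _))) ⟩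
    ∑[ x ∈ allZmod m ] (𝟙 (x ≟Z t) * 1)  ≡⟨ ∑-≟ t (λ _ → 1) ⟩
    1                                    ∎

  infixl 6 _-ₘ_
  _-ₘ_ : Zmod m → Zmod m → Zmod m
  a -ₘ b = a +ₘ -ₘ b

  invertible-‿ : ∀ {a} → Invertible (-ₘ a) ⇔ Invertible a
  invertible-‿ {a} = mk⇔
    (λ (b , -ab≡1) → -ₘ b , trans (solve 2 (λ a b → a :* (:- b) := (:- a) :* b) refl a b) -ab≡1)
    (λ (b , ab≡1) → -ₘ b , trans (solve 2 (λ a b → (:- a) :* (:- b) := a :* b) refl a b) ab≡1)

  solution-unique : ∀ {s s⁻¹} → s *ₘ s⁻¹ ≡ 1ₘ → ∀ b t c → (c *ₘ s +ₘ b ≡ t) ⇔ (c ≡ (t -ₘ b) *ₘ s⁻¹)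
  solution-unique {s} {s⁻¹} ss⁻¹≡1 b t c = mk⇔ to from
    where
    to : c *ₘ s +ₘ b ≡ t → c ≡ (t -ₘ b) *ₘ s⁻¹
    to eq = begin
      c                            ≡⟨ solve 1 (λ c → c := c :* :1) refl c ⟩
      c *ₘ 1ₘ                      ≡⟨ cong (c *ₘ_) ss⁻¹≡1 ⟨
      c *ₘ (s *ₘ s⁻¹)
        ≡⟨ solve 4 (λ c s s⁻¹ b → c :* (s :* s⁻¹) := (c :* s :+ b :- b) :* s⁻¹) refl c s s⁻¹ b ⟩
      (c *ₘ s +ₘ b -ₘ b) *ₘ s⁻¹    ≡⟨ cong (λ x → (x -ₘ b) *ₘ s⁻¹) eq ⟩
      (t -ₘ b) *ₘ s⁻¹              ∎
    from : c ≡ (t -ₘ b) *ₘ s⁻¹ → c *ₘ s +ₘ b ≡ t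
    from eq = begin
      c *ₘ s +ₘ b                       ≡⟨ cong (λ x → x *ₘ s +ₘ b) eq ⟩
      (t -ₘ b) *ₘ s⁻¹ *ₘ s +ₘ b
        ≡⟨ solve 4 (λ t b s s⁻¹ → (t :- b) :* s⁻¹ :* s :+ b := (t :- b) :* (s :* s⁻¹) :+ b) refl t b s s⁻¹ ⟩
      (t -ₘ b) *ₘ (s *ₘ s⁻¹) +ₘ b       ≡⟨ cong (λ x → (t -ₘ b) *ₘ x +ₘ b) ss⁻¹≡1 ⟩
      (t -ₘ b) *ₘ 1ₘ +ₘ b               ≡⟨ solve 2 (λ t b → (t :- b) :* :1 :+ b := t) refl t b ⟩
      t                                 ∎

  ∑-affine-solutions : ∀ s b t →
                       (∑[ c ∈ allZmod m ] 𝟙 ((c *ₘ s +ₘ b) ≟Z t)) * 𝟙 (invertible? s) ≡ 𝟙 (invertible? s)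
  ∑-affine-solutions s b t = count (invertible? s)
    where
    solutions = ∑[ c ∈ allZmod m ] 𝟙 ((c *ₘ s +ₘ b) ≟Z t)
    count : (s? : Dec (Invertible s)) → solutions * 𝟙 s? ≡ 𝟙 s?
    count (no _)               = ℕ.*-zeroʳ solutions
    count (yes (s⁻¹ , ss⁻¹≡1)) =
      trans (ℕ.*-identityʳ _) (∑-unique (λ c → (c *ₘ s +ₘ b) ≟Z t) _ (solution-unique ss⁻¹≡1 b t))

  mat-cong : ∀ {a b c d a′ b′ c′ d′ : Zmod m} → a ≡ a′ → b ≡ b′ → c ≡ c′ → d ≡ d′ → mat a b c d ≡ mat a′ b′ c′ d′
  mat-cong refl refl refl refl = refl

  Mᵢ-· : ∀ c p q r s → Mᵢ c · mat p q r s ≡ mat (c *ₘ p -ₘ r) (c *ₘ q -ₘ s) p q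
  Mᵢ-· c p q r s = mat-cong (cx+[-1]y≡cx-y c p r) (cx+[-1]y≡cx-y c q s) (1x+0y≡x p r) (1x+0y≡x q s)
    where
    cx+[-1]y≡cx-y : ∀ c x y → c *ₘ x +ₘ -ₘ 1ₘ *ₘ y ≡ c *ₘ x -ₘ y
    cx+[-1]y≡cx-y = solve 3 (λ c x y → c :* x :+ (:- :1) :* y := c :* x :- y) refl
    1x+0y≡x : ∀ x y → 1ₘ *ₘ x +ₘ 0ₘ *ₘ y ≡ x
    1x+0y≡x = solve 2 (λ x y → :1 :* x :+ :0 :* y := x) refl

  -- the product of Mᵢ(c)⁻¹ = (0 1; −1 c) with a matrix
  Mᵢ⁻¹_·_ : Zmod m → Mat2 m → Mat2 m
  Mᵢ⁻¹ c · mat p q r s = mat r s (c *ₘ r -ₘ p) (c *ₘ s -ₘ q)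

  x-[x-y]≡y : ∀ x y → x -ₘ (x -ₘ y) ≡ y
  x-[x-y]≡y = solve 2 (λ x y → x :- (x :- y) := y) refl

  Mᵢ⁻¹-·-Mᵢ : ∀ c P → Mᵢ⁻¹ c · (Mᵢ c · P) ≡ P
  Mᵢ⁻¹-·-Mᵢ c (mat p q r s) =
    trans (cong (Mᵢ⁻¹ c ·_) (Mᵢ-· c p q r s)) (mat-cong refl refl (x-[x-y]≡y (c *ₘ p) r) (x-[x-y]≡y (c *ₘ q) s))

  Mᵢ-·-Mᵢ⁻¹ : ∀ c Q → Mᵢ c · (Mᵢ⁻¹ c · Q) ≡ Q
  Mᵢ-·-Mᵢ⁻¹ c (mat p q r s) =
    trans (Mᵢ-· c r s _ _) (mat-cong (x-[x-y]≡y (c *ₘ r) p) (x-[x-y]≡y (c *ₘ s) q) refl refl)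

  Mᵢ-·≡⇔≡Mᵢ⁻¹-· : ∀ c P Q → (Mᵢ c · P ≡ Q) ⇔ (P ≡ Mᵢ⁻¹ c · Q)
  Mᵢ-·≡⇔≡Mᵢ⁻¹-· c P Q = mk⇔
    (λ eq → trans (sym (Mᵢ⁻¹-·-Mᵢ c P)) (cong (Mᵢ⁻¹ c ·_) eq))
    (λ eq → trans (cong (Mᵢ c ·_) eq) (Mᵢ-·-Mᵢ⁻¹ c Q))

  det-Mᵢ⁻¹-· : ∀ c Q → det (Mᵢ⁻¹ c · Q) ≡ det Q
  det-Mᵢ⁻¹-· c (mat p q r s) =
    solve 5 (λ c p q r s → r :* (c :* s :- q) :- s :* (c :* r :- p) := p :* s :- q :* r) refl c p q r s

  𝟙SL₂ : Mat2 m → ℕ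
  𝟙SL₂ B = 𝟙 (det B ≟Z 1ₘ)

  𝟙SL₂-Mᵢ⁻¹-· : ∀ c B → 𝟙SL₂ (Mᵢ⁻¹ c · B) ≡ 𝟙SL₂ B
  𝟙SL₂-Mᵢ⁻¹-· c B = cong (λ d → 𝟙 (d ≟Z 1ₘ)) (det-Mᵢ⁻¹-· c B)

  Mk-acc-∷ʳ : ∀ {k} A (u : Vec (Zmod m) k) c → Mk-acc A (u ∷ʳ c) ≡ Mᵢ c · Mk-acc A u
  Mk-acc-∷ʳ A []      c = refl
  Mk-acc-∷ʳ A (a ∷ u) c = Mk-acc-∷ʳ (Mᵢ a · A) u c

  Mk₂ : ∀ a₁ a₂ → Mk (a₁ ∷ a₂ ∷ []) ≡ mat (a₂ *ₘ a₁ -ₘ 1ₘ) (-ₘ a₂) a₁ (-ₘ 1ₘ)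
  Mk₂ a₁ a₂ = begin
    Mᵢ a₂ · (Mᵢ a₁ · mat 1ₘ 0ₘ 0ₘ 1ₘ)                       ≡⟨ cong (Mᵢ a₂ ·_) (Mᵢ-· a₁ 1ₘ 0ₘ 0ₘ 1ₘ) ⟩
    Mᵢ a₂ · mat (a₁ *ₘ 1ₘ -ₘ 0ₘ) (a₁ *ₘ 0ₘ -ₘ 1ₘ) 1ₘ 0ₘ    ≡⟨ cong (Mᵢ a₂ ·_) (mat-cong x1-0≡x x0-1≡-1 refl refl) ⟩
    Mᵢ a₂ · mat a₁ (-ₘ 1ₘ) 1ₘ 0ₘ                            ≡⟨ Mᵢ-· a₂ a₁ (-ₘ 1ₘ) 1ₘ 0ₘ ⟩
    mat (a₂ *ₘ a₁ -ₘ 1ₘ) (a₂ *ₘ -ₘ 1ₘ -ₘ 0ₘ) a₁ (-ₘ 1ₘ)    ≡⟨ mat-cong refl x[-1]-0≡-x refl refl ⟩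
    mat (a₂ *ₘ a₁ -ₘ 1ₘ) (-ₘ a₂) a₁ (-ₘ 1ₘ)                 ∎
    where
    x1-0≡x : a₁ *ₘ 1ₘ -ₘ 0ₘ ≡ a₁
    x1-0≡x = solve 1 (λ x → x :* :1 :- :0 := x) refl a₁
    x0-1≡-1 : a₁ *ₘ 0ₘ -ₘ 1ₘ ≡ -ₘ 1ₘ
    x0-1≡-1 = solve 1 (λ x → x :* :0 :- :1 := :- :1) refl a₁
    x[-1]-0≡-x : a₂ *ₘ -ₘ 1ₘ -ₘ 0ₘ ≡ -ₘ a₂
    x[-1]-0≡-x = solve 1 (λ x → x :* (:- :1) :- :0 := :- x) refl a₂

  Mk₂≡⇒ : ∀ {a₁ a₂ p q r s} → mat (a₂ *ₘ a₁ -ₘ 1ₘ) (-ₘ a₂) a₁ (-ₘ 1ₘ) ≡ mat p q r s →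
          (a₁ ≡ r × a₂ ≡ -ₘ q) × (InSL2 (mat p q r s) × s ≡ -ₘ 1ₘ)
  Mk₂≡⇒ {a₁} {a₂} refl =
    (refl , solve 1 (λ x → x := :- (:- x)) refl a₂) ,
    (solve 2 (λ a₁ a₂ → (a₂ :* a₁ :- :1) :* (:- :1) :- (:- a₂) :* a₁ := :1) refl a₁ a₂ , refl)

  Mk₂≡⇐ : ∀ {a₁ a₂ p q r s} → (a₁ ≡ r × a₂ ≡ -ₘ q) × (InSL2 (mat p q r s) × s ≡ -ₘ 1ₘ) →
          mat (a₂ *ₘ a₁ -ₘ 1ₘ) (-ₘ a₂) a₁ (-ₘ 1ₘ) ≡ mat p q r s
  Mk₂≡⇐ {p = p} {q} {r} ((refl , refl) , (det≡1 , refl)) =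
    mat-cong [-q]r-1≡p (solve 1 (λ x → :- (:- x) := x) refl q) refl refl
    where
    [-q]r-1≡p : (-ₘ q) *ₘ r -ₘ 1ₘ ≡ p
    [-q]r-1≡p = begin
      (-ₘ q) *ₘ r -ₘ 1ₘ                       ≡⟨ cong (λ x → (-ₘ q) *ₘ r -ₘ x) det≡1 ⟨
      (-ₘ q) *ₘ r -ₘ (p *ₘ -ₘ 1ₘ -ₘ q *ₘ r)
        ≡⟨ solve 3 (λ p q r → (:- q) :* r :- (p :* (:- :1) :- q :* r) := p) refl p q r ⟩
      p                                       ∎

  𝟙-inΔ₂ : ∀ a₁ a₂ p q r s → let B = mat p q r s in
           𝟙 (inΔ? B (a₁ ∷ a₂ ∷ [])) ≡
           𝟙 (a₁ ≟Z r) * (𝟙 (a₂ ≟Z (-ₘ q)) * (𝟙SL₂ B * 𝟙 (s ≟Z (-ₘ 1ₘ)) * 𝟙 (invertible? a₂)))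
  𝟙-inΔ₂ a₁ a₂ p q r s = begin
    𝟙 (Mk₂? ×-dec inv?)                                              ≡⟨ 𝟙-× Mk₂? inv? ⟩
    𝟙 Mk₂? * 𝟙 inv?                                                  ≡⟨ cong (_* 𝟙 inv?) (𝟙-cong Mk₂≡⇔ Mk₂? (same? ×-dec sl?)) ⟩
    𝟙 (same? ×-dec sl?) * 𝟙 inv?                                     ≡⟨ cong (_* 𝟙 inv?) (𝟙-× same? sl?) ⟩
    𝟙 same? * 𝟙 sl? * 𝟙 inv?
      ≡⟨ cong (λ n → n * 𝟙 inv?) (cong₂ _*_ (𝟙-× (a₁ ≟Z r) (a₂ ≟Z (-ₘ q))) (𝟙-× (det B ≟Z 1ₘ) (s ≟Z (-ₘ 1ₘ)))) ⟩
    𝟙 (a₁ ≟Z r) * 𝟙 (a₂ ≟Z (-ₘ q)) * (𝟙SL₂ B * 𝟙 (s ≟Z (-ₘ 1ₘ))) * 𝟙 inv?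
      ≡⟨ trans (ℕ.*-assoc (𝟙 (a₁ ≟Z r) * 𝟙 (a₂ ≟Z (-ₘ q))) _ _) (ℕ.*-assoc (𝟙 (a₁ ≟Z r)) _ _) ⟩
    𝟙 (a₁ ≟Z r) * (𝟙 (a₂ ≟Z (-ₘ q)) * (𝟙SL₂ B * 𝟙 (s ≟Z (-ₘ 1ₘ)) * 𝟙 inv?))  ∎
    where
    B = mat p q r s
    Mk₂? = Mk (a₁ ∷ a₂ ∷ []) ≟M B
    inv? = invertible? a₂
    same? = a₁ ≟Z r ×-dec a₂ ≟Z (-ₘ q)
    sl? = det B ≟Z 1ₘ ×-dec s ≟Z (-ₘ 1ₘ)
    Mk₂≡⇔ : (Mk (a₁ ∷ a₂ ∷ []) ≡ B) ⇔ ((a₁ ≡ r × a₂ ≡ -ₘ q) × (InSL2 B × s ≡ -ₘ 1ₘ))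
    Mk₂≡⇔ = subst (λ M → (M ≡ B) ⇔ ((a₁ ≡ r × a₂ ≡ -ₘ q) × (InSL2 B × s ≡ -ₘ 1ₘ))) (sym (Mk₂ a₁ a₂)) (mk⇔ Mk₂≡⇒ Mk₂≡⇐)

  cardΔ-∑ : ∀ k B → cardΔ m k B ≡ ∑[ v ∈ allVecs (allZmod m) k ] 𝟙 (inΔ? B v)
  cardΔ-∑ k B = length-filter (inΔ? B) (allVecs (allZmod m) k)

  cardΔ-2 : ∀ B → cardΔ m 2 B ≡ 𝟙SL₂ B * 𝟙 (Mat2.e22 B ≟Z (-ₘ 1ₘ)) * 𝟙 (invertible? (-ₘ Mat2.e12 B))
  cardΔ-2 B@(mat p q r s) = begin
    cardΔ m 2 B                                                       ≡⟨ cardΔ-∑ 2 B ⟩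
    ∑[ v ∈ allVecs R 2 ] 𝟙 (inΔ? B v)                                  ≡⟨ ∑-allVecs-∷ R 1 _ ⟩
    ∑[ a₁ ∈ R ] ∑[ w ∈ allVecs R 1 ] 𝟙 (inΔ? B (a₁ ∷ w))               ≡⟨ ∑-cong R (λ a₁ → ∑-allVecs-1 R _) ⟩
    ∑[ a₁ ∈ R ] ∑[ a₂ ∈ R ] 𝟙 (inΔ? B (a₁ ∷ a₂ ∷ []))                  ≡⟨ ∑-cong R (λ a₁ → ∑-cong R (λ a₂ → 𝟙-inΔ₂ a₁ a₂ p q r s)) ⟩
    ∑[ a₁ ∈ R ] ∑[ a₂ ∈ R ] (𝟙 (a₁ ≟Z r) * (𝟙 (a₂ ≟Z (-ₘ q)) * K a₂))    ≡⟨ ∑-cong R (λ a₁ → ∑-*ˡ R (𝟙 (a₁ ≟Z r)) _) ⟩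
    ∑[ a₁ ∈ R ] (𝟙 (a₁ ≟Z r) * ∑[ a₂ ∈ R ] (𝟙 (a₂ ≟Z (-ₘ q)) * K a₂))    ≡⟨ ∑-≟ r _ ⟩
    ∑[ a₂ ∈ R ] (𝟙 (a₂ ≟Z (-ₘ q)) * K a₂)                                ≡⟨ ∑-≟ (-ₘ q) K ⟩
    K (-ₘ q)                                                          ∎
    where
    R = allZmod m
    K : Zmod m → ℕ
    K a₂ = 𝟙SL₂ B * 𝟙 (s ≟Z (-ₘ 1ₘ)) * 𝟙 (invertible? a₂)

  InΔ-∷ʳ : ∀ {k} B (u : Vec (Zmod m) (2 + k)) c → InΔ B (u ∷ʳ c) ⇔ InΔ (Mᵢ⁻¹ c · B) u
  InΔ-∷ʳ B u@(_ ∷ _ ∷ _) c = Mk-∷ʳ≡⇔ ×-⇔ ⇔.refl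
    where
    Mk-∷ʳ≡⇔ : (Mk (u ∷ʳ c) ≡ B) ⇔ (Mk u ≡ Mᵢ⁻¹ c · B)
    Mk-∷ʳ≡⇔ = subst (λ M → (M ≡ B) ⇔ (Mk u ≡ Mᵢ⁻¹ c · B)) (sym (Mk-acc-∷ʳ I₂ u c))
                    (Mᵢ-·≡⇔≡Mᵢ⁻¹-· c (Mk u) B)

  cardΔ-step : ∀ k B → cardΔ m (3 + k) B ≡ ∑[ c ∈ allZmod m ] cardΔ m (2 + k) (Mᵢ⁻¹ c · B)
  cardΔ-step k B = begin
    cardΔ m (3 + k) B                                               ≡⟨ cardΔ-∑ (3 + k) B ⟩
    ∑[ v ∈ Vecs (3 + k) ] 𝟙 (inΔ? B v)                               ≡⟨ ∑-allVecs-∷ʳ R (2 + k) _ ⟩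
    ∑[ u ∈ Vecs (2 + k) ] ∑[ c ∈ R ] 𝟙 (inΔ? B (u ∷ʳ c))
      ≡⟨ ∑-cong (Vecs (2 + k)) (λ u → ∑-cong R (λ c → 𝟙-cong (InΔ-∷ʳ B u c) (inΔ? B (u ∷ʳ c)) (inΔ? (Mᵢ⁻¹ c · B) u))) ⟩
    ∑[ u ∈ Vecs (2 + k) ] ∑[ c ∈ R ] 𝟙 (inΔ? (Mᵢ⁻¹ c · B) u)          ≡⟨ ∑-swap (Vecs (2 + k)) R _ ⟩
    ∑[ c ∈ R ] ∑[ u ∈ Vecs (2 + k) ] 𝟙 (inΔ? (Mᵢ⁻¹ c · B) u)          ≡⟨ ∑-cong R (λ c → cardΔ-∑ (2 + k) (Mᵢ⁻¹ c · B)) ⟨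
    ∑[ c ∈ R ] cardΔ m (2 + k) (Mᵢ⁻¹ c · B)                          ∎
    where
    R = allZmod m
    Vecs = allVecs R

  cardΔ-3 : ∀ B → cardΔ m 3 B ≡ 𝟙SL₂ B * 𝟙 (invertible? (Mat2.e22 B))
  cardΔ-3 B@(mat p q r s) = begin
    cardΔ m 3 B                                                      ≡⟨ cardΔ-step 0 B ⟩
    ∑[ c ∈ R ] cardΔ m 2 (Mᵢ⁻¹ c · B)                                 ≡⟨ ∑-cong R (λ c → cardΔ-2 (Mᵢ⁻¹ c · B)) ⟩
    ∑[ c ∈ R ] (𝟙SL₂ (Mᵢ⁻¹ c · B) * 𝟙 (e c) * 𝟙 (invertible? (-ₘ s)))
      ≡⟨ ∑-cong R (λ c → cong (λ n → n * 𝟙 (e c) * 𝟙 (invertible? (-ₘ s))) (𝟙SL₂-Mᵢ⁻¹-· c B)) ⟩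
    ∑[ c ∈ R ] (𝟙SL₂ B * 𝟙 (e c) * 𝟙 (invertible? (-ₘ s)))             ≡⟨ ∑-*ʳ R _ _ ⟩
    ∑[ c ∈ R ] (𝟙SL₂ B * 𝟙 (e c)) * 𝟙 (invertible? (-ₘ s))
      ≡⟨ cong₂ _*_ (∑-*ˡ R (𝟙SL₂ B) (𝟙 ∘ e)) (𝟙-cong (invertible-‿ {a = s}) (invertible? (-ₘ s)) (invertible? s)) ⟩
    𝟙SL₂ B * ∑[ c ∈ R ] 𝟙 (e c) * 𝟙 (invertible? s)                   ≡⟨ ℕ.*-assoc (𝟙SL₂ B) (∑ R (𝟙 ∘ e)) _ ⟩
    𝟙SL₂ B * (∑[ c ∈ R ] 𝟙 (e c) * 𝟙 (invertible? s))                 ≡⟨ cong (𝟙SL₂ B *_) (∑-affine-solutions s (-ₘ q) (-ₘ 1ₘ)) ⟩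
    𝟙SL₂ B * 𝟙 (invertible? s)                                        ∎
    where
    R = allZmod m
    e = λ c → (c *ₘ s -ₘ q) ≟Z (-ₘ 1ₘ)

-- Parity in ℤ/2^(m+1)ℤ

*≡1ℙ⇒≡1ℙ : ∀ p q → p ℙ.* q ≡ 1ℙ → p ≡ 1ℙ × q ≡ 1ℙ
*≡1ℙ⇒≡1ℙ 1ℙ q pq≡1 = refl , pq≡1
*≡1ℙ⇒≡1ℙ 0ℙ q ()

odd-∣⇒odd : ∀ {d n} → d ∣ n → parity n ≡ 1ℙ → parity d ≡ 1ℙ
odd-∣⇒odd {d} (divides q refl) odd =
  proj₂ (*≡1ℙ⇒≡1ℙ (parity q) (parity d) (trans (sym (ℙ.*-homo-* q d)) odd))

odd-∣2⇒≡1 : ∀ {d} → parity d ≡ 1ℙ → d ∣ 2 → d ≡ 1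
odd-∣2⇒≡1 {0}                   _  0∣2 = contradiction (0∣⇒≡0 0∣2) λ ()
odd-∣2⇒≡1 {1}                   _  _   = refl
odd-∣2⇒≡1 {suc (suc (suc _))}   _  d∣2 = contradiction (∣⇒≤ d∣2) λ { (s≤s (s≤s ())) }

odd⇒coprime-2^ : ∀ {n} → parity n ≡ 1ℙ → ∀ k → Coprime n (2 ^ k)
odd⇒coprime-2^ odd zero    (_ , d∣1)         = ∣1⇒≡1 d∣1
odd⇒coprime-2^ odd (suc k) (d∣n , d∣2*2^k) = odd⇒coprime-2^ odd k (d∣n , coprime-divisor d⊥2 d∣2*2^k)
  where
  d⊥2 : Coprime _ 2
  d⊥2 (e∣d , e∣2) = odd-∣2⇒≡1 (odd-∣⇒odd (∣-trans e∣d d∣n) odd) e∣2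

𝟙odd : Parity → ℕ
𝟙odd p = 𝟙 (p ℙ.≟ 1ℙ)

module _ {m : ℕ} where
  private instance
    N-nonZero : NonZero (N (suc m))
    N-nonZero = ℕ.m^n≢0 2 (suc m)
  open ℤ-CoefficientSolver (Zmod-commutativeRing (suc m)) using (solve; _:=_; _:+_; _:*_; :-_; _:-_; :0; :1)

  parityₘ : Zmod (suc m) → Parity
  parityₘ a = parity (rep a)

  parity-% : ∀ x → parity (x % N (suc m)) ≡ parity x
  parity-% x = sym (begin
    parity x                                       ≡⟨ cong parity (m≡m%n+[m/n]*n x M) ⟩
    parity (x % M + x / M * M)                     ≡⟨ ℙ.+-homo-+ (x % M) (x / M * M) ⟩
    parity (x % M) ℙ.+ parity (x / M * M)          ≡⟨ cong (parity (x % M) ℙ.+_) (ℙ.*-homo-* (x / M) M) ⟩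
    parity (x % M) ℙ.+ (parity (x / M) ℙ.* parity M)
      ≡⟨ cong (λ p → parity (x % M) ℙ.+ (parity (x / M) ℙ.* p)) (ℙ.*-homo-* 2 (2 ^ m)) ⟩
    parity (x % M) ℙ.+ (parity (x / M) ℙ.* 0ℙ)    ≡⟨ cong (parity (x % M) ℙ.+_) (ℙ.*-zeroʳ (parity (x / M))) ⟩
    parity (x % M) ℙ.+ 0ℙ                          ≡⟨ ℙ.+-identityʳ (parity (x % M)) ⟩
    parity (x % M)                                 ∎)
    where M = N (suc m)

  parityₘ-[]ₘ : ∀ x → parityₘ [ x ]ₘ ≡ parity x
  parityₘ-[]ₘ x = trans (cong parity (rep-[]ₘ {suc m} x)) (parity-% x)

  parityₘ-+ : ∀ a b → parityₘ (a +ₘ b) ≡ parityₘ a ℙ.+ parityₘ b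
  parityₘ-+ a b = trans (parityₘ-[]ₘ (rep a + rep b)) (ℙ.+-homo-+ (rep a) (rep b))

  parityₘ-* : ∀ a b → parityₘ (a *ₘ b) ≡ parityₘ a ℙ.* parityₘ b
  parityₘ-* a b = trans (parityₘ-[]ₘ (rep a * rep b)) (ℙ.*-homo-* (rep a) (rep b))

  parityₘ-‿ : ∀ a → parityₘ (-ₘ a) ≡ parityₘ a
  parityₘ-‿ a = ℙ.+-cancelˡ-≡ (parityₘ a) _ _ (begin
    parityₘ a ℙ.+ parityₘ (-ₘ a)   ≡⟨ parityₘ-+ a (-ₘ a) ⟨
    parityₘ (a +ₘ -ₘ a)            ≡⟨ cong parityₘ (trans (+ₘ-comm a (-ₘ a)) (-ₘ-inverseˡ a)) ⟩
    parityₘ 0ₘ                     ≡⟨ parityₘ-[]ₘ 0 ⟩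
    0ℙ                             ≡⟨ ℙ.p+p≡0ℙ (parityₘ a) ⟨
    parityₘ a ℙ.+ parityₘ a        ∎)

  parityₘ-[xy-z] : ∀ c s q → parityₘ (c *ₘ s -ₘ q) ≡ parityₘ c ℙ.* parityₘ s ℙ.+ parityₘ q
  parityₘ-[xy-z] c s q = trans (parityₘ-+ (c *ₘ s) (-ₘ q)) (cong₂ ℙ._+_ (parityₘ-* c s) (parityₘ-‿ q))

  invertible⇒odd : ∀ a → Invertible a → parityₘ a ≡ 1ℙ
  invertible⇒odd a (b , ab≡1) = proj₁ (*≡1ℙ⇒≡1ℙ (parityₘ a) (parityₘ b) (begin
    parityₘ a ℙ.* parityₘ b   ≡⟨ parityₘ-* a b ⟨
    parityₘ (a *ₘ b)          ≡⟨ cong parityₘ ab≡1 ⟩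
    parityₘ 1ₘ                ≡⟨ parityₘ-[]ₘ 1 ⟩
    1ℙ                        ∎))

  odd⇒invertible : ∀ a → parityₘ a ≡ 1ℙ → Invertible a
  odd⇒invertible a odd with coprime-Bézout (odd⇒coprime-2^ odd (suc m))
  ... | Bézout.+- x y 1+yN≡xa = [ x ]ₘ , (begin
    a *ₘ [ x ]ₘ                 ≡⟨ cong (_*ₘ [ x ]ₘ) ([]ₘ-rep a) ⟨
    [ rep a ]ₘ *ₘ [ x ]ₘ        ≡⟨ []ₘ-* (rep a) x ⟩
    [ rep a * x ]ₘ              ≡⟨ cong [_]ₘ (trans (ℕ.*-comm (rep a) x) (sym 1+yN≡xa)) ⟩
    [ 1 + y * N (suc m) ]ₘ      ≡⟨ []ₘ-cong-% ([m+kn]%n≡m%n 1 y (N (suc m))) ⟩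
    1ₘ                          ∎)
  ... | Bézout.-+ x y 1+xa≡yN = -ₘ [ x ]ₘ , (begin
    a *ₘ -ₘ [ x ]ₘ                    ≡⟨ solve 2 (λ a x → a :* (:- x) := :1 :- (:1 :+ x :* a)) refl a [ x ]ₘ ⟩
    1ₘ -ₘ (1ₘ +ₘ [ x ]ₘ *ₘ a)         ≡⟨ cong (λ t → 1ₘ -ₘ (1ₘ +ₘ [ x ]ₘ *ₘ t)) ([]ₘ-rep a) ⟨
    1ₘ -ₘ (1ₘ +ₘ [ x ]ₘ *ₘ [ rep a ]ₘ) ≡⟨ cong (λ t → 1ₘ -ₘ (1ₘ +ₘ t)) ([]ₘ-* x (rep a)) ⟩
    1ₘ -ₘ (1ₘ +ₘ [ x * rep a ]ₘ)      ≡⟨ cong (λ t → 1ₘ -ₘ t) ([]ₘ-+ 1 (x * rep a)) ⟩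
    1ₘ -ₘ [ 1 + x * rep a ]ₘ          ≡⟨ cong (λ t → 1ₘ -ₘ [ t ]ₘ) 1+xa≡yN ⟩
    1ₘ -ₘ [ y * N (suc m) ]ₘ          ≡⟨ cong (λ t → 1ₘ -ₘ t) ([]ₘ-cong-% ([m+kn]%n≡m%n 0 y (N (suc m)))) ⟩
    1ₘ -ₘ 0ₘ                          ≡⟨ solve 0 (:1 :- :0 := :1) refl ⟩
    1ₘ                                ∎)

  𝟙-invertible : ∀ a → 𝟙 (invertible? a) ≡ 𝟙odd (parityₘ a)
  𝟙-invertible a =
    𝟙-cong (mk⇔ (invertible⇒odd a) (odd⇒invertible a)) (invertible? a) (parityₘ a ℙ.≟ 1ℙ)

  ∑-parity : ∀ (F : Parity → ℕ) → ∑[ x ∈ allZmod (suc m) ] F (parityₘ x) ≡ 2 ^ m * (F 0ℙ + F 1ℙ)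
  ∑-parity F = begin
    ∑[ x ∈ allZmod (suc m) ] F (parityₘ x)                     ≡⟨ ∑-allZmod {suc m} (λ x → F (parityₘ x)) ⟩
    sum (tabulate {n = 2 * 2 ^ m} (λ i → F (parity (toℕ i))))
      ≡⟨ cong (λ n → sum (tabulate {n = n} (λ i → F (parity (toℕ i))))) (ℕ.*-comm 2 (2 ^ m)) ⟩
    sum (tabulate {n = 2 ^ m * 2} (λ i → F (parity (toℕ i))))   ≡⟨ sum-tabulate-parity (2 ^ m) F ⟩
    2 ^ m * (F 0ℙ + F 1ℙ)                                      ∎

-- Parity profiles and the recurrence

transfer : ℕ → (Parity → Parity → ℕ) → Parity → Parity → ℕ
transfer a g x y = a * (g y x + g (x ℙ.+ y) x)

a[au+av]≡a[aw]+2a²z : ∀ a u v w z → u + v ≡ w + 2 * z →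
                      a * (a * u + a * v) ≡ a * (a * w) + 2 * (a * a) * z
a[au+av]≡a[aw]+2a²z a u v w z u+v≡w+2z = begin
  a * (a * u + a * v)             ≡⟨ lhs a u v ⟩
  a * a * (u + v)                 ≡⟨ cong (a * a *_) u+v≡w+2z ⟩
  a * a * (w + 2 * z)             ≡⟨ rhs a w z ⟩
  a * (a * w) + 2 * (a * a) * z   ∎
  where
  lhs : ∀ a u v → a * (a * u + a * v) ≡ a * a * (u + v)
  lhs = ℕ-Solver.solve-∀
  rhs : ∀ a w z → a * a * (w + 2 * z) ≡ a * (a * w) + 2 * (a * a) * z
  rhs = ℕ-Solver.solve-∀

module _ (a : ℕ) where

  profile : ℕ → Parity → Parity → ℕ
  profile zero    x y = 𝟙odd x
  profile (suc k)     = transfer a (profile k)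

  transfer-cong : ∀ {f g} → (∀ x y → f x y ≡ g x y) → ∀ x y → transfer a f x y ≡ transfer a g x y
  transfer-cong f≗g x y = cong₂ (λ u v → a * (u + v)) (f≗g y x) (f≗g (x ℙ.+ y) x)

  transfer-linear : ∀ u v f g x y →
                    transfer a (λ x y → u * f x y + v * g x y) x y ≡ u * transfer a f x y + v * transfer a g x y
  transfer-linear u v f g x y = distrib a u v (f y x) (f (x ℙ.+ y) x) (g y x) (g (x ℙ.+ y) x)
    where
    distrib : ∀ a u v f₁ f₂ g₁ g₂ →
              a * ((u * f₁ + v * g₁) + (u * f₂ + v * g₂)) ≡ u * (a * (f₁ + f₂)) + v * (a * (g₁ + g₂))
    distrib = ℕ-Solver.solve-∀

  profile-recurrence : ∀ k x y →
                       profile (2 + k) x y ≡ a * profile (1 + k) x y + 2 * (a * a) * profile k x y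
  profile-recurrence zero    0ℙ 0ℙ = a[au+av]≡a[aw]+2a²z a 0 0 0 0 refl
  profile-recurrence zero    0ℙ 1ℙ = a[au+av]≡a[aw]+2a²z a 1 1 2 0 refl
  profile-recurrence zero    1ℙ 0ℙ = a[au+av]≡a[aw]+2a²z a 2 1 1 1 refl
  profile-recurrence zero    1ℙ 1ℙ = a[au+av]≡a[aw]+2a²z a 1 2 1 1 refl
  profile-recurrence (suc k) x  y  = trans (transfer-cong (profile-recurrence k) x y)
                                           (transfer-linear a (2 * (a * a)) (profile (1 + k)) (profile k) x y)

module _ {m : ℕ} where

  weight : (Parity → Parity → ℕ) → Mat2 (suc m) → ℕ
  weight g B = 𝟙SL₂ B * g (parityₘ (Mat2.e22 B)) (parityₘ (Mat2.e12 B))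

  weight-step : ∀ g B → ∑[ c ∈ allZmod (suc m) ] weight g (Mᵢ⁻¹ c · B) ≡ weight (transfer (2 ^ m) g) B
  weight-step g B@(mat p q r s) = begin
    ∑[ c ∈ R ] (𝟙SL₂ (Mᵢ⁻¹ c · B) * g (parityₘ (c *ₘ s -ₘ q)) (parityₘ s))
      ≡⟨ ∑-cong R (λ c → cong₂ (λ n x → n * g x (parityₘ s)) (𝟙SL₂-Mᵢ⁻¹-· c B) (parityₘ-[xy-z] c s q)) ⟩
    ∑[ c ∈ R ] (𝟙SL₂ B * G (parityₘ c))    ≡⟨ ∑-*ˡ R (𝟙SL₂ B) (G ∘ parityₘ) ⟩
    𝟙SL₂ B * ∑[ c ∈ R ] G (parityₘ c)      ≡⟨ cong (𝟙SL₂ B *_) (∑-parity {m} G) ⟩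
    𝟙SL₂ B * (2 ^ m * (G 0ℙ + G 1ℙ))       ∎
    where
    R = allZmod (suc m)
    G : Parity → ℕ
    G pc = g (pc ℙ.* parityₘ s ℙ.+ parityₘ q) (parityₘ s)

  cardΔ-profile : ∀ k B → cardΔ (suc m) (3 + k) B ≡ weight (profile (2 ^ m) k) B
  cardΔ-profile zero    B@(mat p q r s) = trans (cardΔ-3 B) (cong (𝟙SL₂ B *_) (𝟙-invertible s))
  cardΔ-profile (suc k) B = begin
    cardΔ (suc m) (4 + k) B                                    ≡⟨ cardΔ-step (suc k) B ⟩
    ∑[ c ∈ R ] cardΔ (suc m) (3 + k) (Mᵢ⁻¹ c · B)               ≡⟨ ∑-cong R (λ c → cardΔ-profile k (Mᵢ⁻¹ c · B)) ⟩
    ∑[ c ∈ R ] weight (profile (2 ^ m) k) (Mᵢ⁻¹ c · B)          ≡⟨ weight-step (profile (2 ^ m) k) B ⟩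
    weight (profile (2 ^ m) (suc k)) B                         ∎
    where R = allZmod (suc m)

  cardΔ-recurrence : ∀ k B → cardΔ (suc m) (5 + k) B ≡
                     2 ^ m * cardΔ (suc m) (4 + k) B + 2 * (2 ^ m * 2 ^ m) * cardΔ (suc m) (3 + k) B
  cardΔ-recurrence k B = begin
    cardΔ (suc m) (5 + k) B                                    ≡⟨ cardΔ-profile (2 + k) B ⟩
    χ * profile a (2 + k) x y                                  ≡⟨ cong (χ *_) (profile-recurrence a k x y) ⟩
    χ * (a * profile a (1 + k) x y + c * profile a k x y)      ≡⟨ distrib χ a c (profile a (1 + k) x y) (profile a k x y) ⟩
    a * (χ * profile a (1 + k) x y) + c * (χ * profile a k x y)
      ≡⟨ cong₂ (λ u v → a * u + c * v) (cardΔ-profile (1 + k) B) (cardΔ-profile k B) ⟨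
    a * cardΔ (suc m) (4 + k) B + c * cardΔ (suc m) (3 + k) B  ∎
    where
    a = 2 ^ m
    c = 2 * (a * a)
    χ = 𝟙SL₂ B
    x = parityₘ (Mat2.e22 B)
    y = parityₘ (Mat2.e12 B)
    distrib : ∀ χ a c u v → χ * (a * u + c * v) ≡ a * (χ * u) + c * (χ * v)
    distrib = ℕ-Solver.solve-∀

2^[2[1+m]∸1]≡2[2^m*2^m] : ∀ m → 2 ^ (2 * suc m ∸ 1) ≡ 2 * (2 ^ m * 2 ^ m)
2^[2[1+m]∸1]≡2[2^m*2^m] m = begin
  2 ^ (m + suc (m + 0))        ≡⟨ ℕ.^-distribˡ-+-* 2 m (suc (m + 0)) ⟩
  2 ^ m * (2 * 2 ^ (m + 0))    ≡⟨ cong (λ n → 2 ^ m * (2 * 2 ^ n)) (ℕ.+-identityʳ m) ⟩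
  2 ^ m * (2 * 2 ^ m)          ≡⟨ x[2x]≡2[xx] (2 ^ m) ⟩
  2 * (2 ^ m * 2 ^ m)          ∎
  where
  x[2x]≡2[xx] : ∀ x → x * (2 * x) ≡ 2 * (x * x)
  x[2x]≡2[xx] = ℕ-Solver.solve-∀

proposition2p3 : (m : ℕ) → 2 ≤ m → (B : Mat2 m) → InSL2 B → (n : ℕ) → 4 < n →
    cardΔ m n B ≡ 2 ^ (m ∸ 1) * cardΔ m (n ∸ 1) B + 2 ^ (2 * m ∸ 1) * cardΔ m (n ∸ 2) B
proposition2p3 (suc m) (s≤s _) B _ (suc (suc (suc (suc (suc k))))) (s≤s (s≤s (s≤s (s≤s (s≤s _))))) = begin
  cardΔ (suc m) (5 + k) B                                        ≡⟨ cardΔ-recurrence k B ⟩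
  2 ^ m * cardΔ (suc m) (4 + k) B + 2 * (2 ^ m * 2 ^ m) * cardΔ (suc m) (3 + k) B
    ≡⟨ cong (λ c → 2 ^ m * cardΔ (suc m) (4 + k) B + c * cardΔ (suc m) (3 + k) B) (2^[2[1+m]∸1]≡2[2^m*2^m] m) ⟨
  2 ^ m * cardΔ (suc m) (4 + k) B + 2 ^ (2 * suc m ∸ 1) * cardΔ (suc m) (3 + k) B ∎
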